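{- For a strong quasi-MV* algebra $\mathbf{Q}=\langle Q;\oplus,-,{}^+,{}^-,0,1\rangle$ let $f(\mathbf{Q})=\langle Q;\to,\neg,{}^+,{}^-,1\rangle$ where $x\to y:=-x\oplus y$ and $\neg x:=-x$. For a strong quasi-Wajsberg* algebra $\mathbf{S}=\langle S;\to,\neg,{}^+,{}^-,1\rangle$ let $g(\mathbf{S})=\langle S;\oplus,-,{}^+,{}^-,0,1\rangle$ where $0:=x\to x$, $x\oplus y:=\neg x\to y$ and $-x:=\neg x$. Then for every strong quasi-MV* algebra $\mathbf{Q}$ and every strong quasi-Wajsberg* algebra $\mathbf{S}$: (1) $g(f(\mathbf{Q}))=\mathbf{Q}$; (2) $f(g(\mathbf{S}))=\mathbf{S}$.
   Context: A quasi-MV* algebra is an algebra $\langle A;\oplus,-,{}^+,{}^-,0,1\rangle$ of type $\langle 2,1,1,1,0,0\rangle$ such that for all $x,y,z$: (1) $x\oplus y=y\oplus x$; (2) $(1\oplus x)\oplus(y\oplus(1\oplus z))=((1\oplus x)\oplus y)\oplus(1\oplus z)$; (3) $(x\oplus1)\oplus1=1$; (4) $(x\oplus y)\oplus0=x\oplus y$; (5) $x^+\oplus0=(x\oplus0)^+=1\oplus(-1\oplus x)$ and $x^-\oplus0=(x\oplus0)^-=-1\oplus(1\oplus x)$; (6) $x\oplus y=(x^+\oplus y^+)\oplus(x^-\oplus y^-)$; (7) $0=-0$; (8) $x\oplus(-x)=0$; (9) $-(x\oplus y)=(-x)\oplus(-y)$; (10) $-(-x)=x$; (11) $(-x\oplus(x\oplus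 y))^+=-x^+\oplus(x^+\oplus y^+)$; (12)–(14) $\vee$ is commutative, associative, and $x\oplus(y\vee z)=(x\oplus y)\vee(x\oplus z)$; where $x\vee y:=(x^+\oplus(-x^+\oplus y^+)^+)\oplus(x^-\oplus(-x^-\oplus y^-)^+)$. It is strong if $x^+=x^+\oplus0$ and $x^-=x^-\oplus0$ for all $x$. A quasi-Wajsberg* algebra is an algebra $\langle W;\to,\neg,{}^+,{}^-,1\rangle$ of type $\langle2,1,1,1,0\rangle$ such that for all $x,y,z$: (QW*1) $x\to y=\neg y\to\neg x$; (QW*2) $(x\to1)\to((y\to1)\to z)=(y\to1)\to((x\to1)\to z)$; (QW*3) $(1\to x)\to1=1$; (QW*4) $(z\to z)\to(x\to y)=x\to y$; (QW*5) $(1\to1)\to x^+=((1\to1)\to x)^+=(x\to1)\to1$ and $(1\to1)\to x^-=((1\to1)\to x)^-=(x\to\neg1)\to\neg1$; (QW*6) $x\to y=(y^+\to x^-)\to(x^+\to y^-)$; (QW*7) $\neg(x\to y)=y\to x$; (QW*8) $\neg\neg x=x$; (QW*9) $(x\to(\neg x\to y))^+=x^+\to(\neg x^+\to y^+)$; (QW*10)–(QW*12) $\vee$ is commutative, associative, and $x\to(y\vee z)=(x\to y)\vee(x\to z)$; where $x\vee y:=((x^+\to y^+)^+\to(\neg x)^-)\to((y^-\to x^-)^-\to x^-)$. In such an algebra $x\to x$ does not depend on $x$. It is strong if $x^+=(1\to1)\to x^+$ and $x^-=(1\to1)\to x^-$ for all $x$. -}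

module Defs where

open import Level using (Level)
open import Data.Product using (_×_)
open import Relation.Binary.PropositionalEquality using (_≡_)

private
  variable
    a : Level

record MVSig (A : Set a) : Set a where
  infixl 6 _⊕_
  field
    _⊕_ : A → A → A
    ⊖_  : A → A
    _⁺  : A → A
    _⁻  : A → A
    𝟎   : A
    𝟏   : A

  _∨_ : A → A → A
  x ∨ y = ((x ⁺) ⊕ ((⊖ (x ⁺)) ⊕ (y ⁺)) ⁺) ⊕ ((x ⁻) ⊕ ((⊖ (x ⁻)) ⊕ (y ⁻)) ⁺)

record WSig (A : Set a) : Set a where
  infixr 5 _⇒_
  field
    _⇒_ : A → A → A
    ¬′_ : A → A
    _⁺  : A → A
    _⁻  : A → A
    𝟏   : A

  _∨_ : A → A → A
  x ∨ y = (((x ⁺ ⇒ y ⁺) ⁺) ⇒ ((¬′ x) ⁻)) ⇒ ((((y ⁻ ⇒ x ⁻) ⁻) ⇒ (x ⁻)))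

record IsStrongQMV* {A : Set a} (M : MVSig A) : Set a where
  open MVSig M
  field
    ax1  : ∀ x y → x ⊕ y ≡ y ⊕ x
    ax2  : ∀ x y z → (𝟏 ⊕ x) ⊕ (y ⊕ (𝟏 ⊕ z)) ≡ ((𝟏 ⊕ x) ⊕ y) ⊕ (𝟏 ⊕ z)
    ax3  : ∀ x → (x ⊕ 𝟏) ⊕ 𝟏 ≡ 𝟏
    ax4  : ∀ x y → (x ⊕ y) ⊕ 𝟎 ≡ x ⊕ y
    ax5a : ∀ x → (x ⁺) ⊕ 𝟎 ≡ (x ⊕ 𝟎) ⁺
    ax5b : ∀ x → (x ⊕ 𝟎) ⁺ ≡ 𝟏 ⊕ ((⊖ 𝟏) ⊕ x)
    ax5c : ∀ x → (x ⁻) ⊕ 𝟎 ≡ (x ⊕ 𝟎) ⁻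
    ax5d : ∀ x → (x ⊕ 𝟎) ⁻ ≡ (⊖ 𝟏) ⊕ (𝟏 ⊕ x)
    ax6  : ∀ x y → x ⊕ y ≡ ((x ⁺) ⊕ (y ⁺)) ⊕ ((x ⁻) ⊕ (y ⁻))
    ax7  : 𝟎 ≡ ⊖ 𝟎
    ax8  : ∀ x → x ⊕ (⊖ x) ≡ 𝟎
    ax9  : ∀ x y → ⊖ (x ⊕ y) ≡ (⊖ x) ⊕ (⊖ y)
    ax10 : ∀ x → ⊖ (⊖ x) ≡ x
    ax11 : ∀ x y → ((⊖ x) ⊕ (x ⊕ y)) ⁺ ≡ (⊖ (x ⁺)) ⊕ ((x ⁺) ⊕ (y ⁺))
    ax12 : ∀ x y → x ∨ y ≡ y ∨ x
    ax13 : ∀ x y z → x ∨ (y ∨ z) ≡ (x ∨ y) ∨ z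
    ax14 : ∀ x y z → x ⊕ (y ∨ z) ≡ (x ⊕ y) ∨ (x ⊕ z)
    strong⁺ : ∀ x → x ⁺ ≡ (x ⁺) ⊕ 𝟎
    strong⁻ : ∀ x → x ⁻ ≡ (x ⁻) ⊕ 𝟎

record IsStrongQW* {A : Set a} (W : WSig A) : Set a where
  open WSig W
  field
    qw1  : ∀ x y → (x ⇒ y) ≡ ((¬′ y) ⇒ (¬′ x))
    qw2  : ∀ x y z → ((x ⇒ 𝟏) ⇒ ((y ⇒ 𝟏) ⇒ z)) ≡ ((y ⇒ 𝟏) ⇒ ((x ⇒ 𝟏) ⇒ z))
    qw3  : ∀ x → ((𝟏 ⇒ x) ⇒ 𝟏) ≡ 𝟏
    qw4  : ∀ x y z → ((z ⇒ z) ⇒ (x ⇒ y)) ≡ (x ⇒ y)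
    qw5a : ∀ x → ((𝟏 ⇒ 𝟏) ⇒ (x ⁺)) ≡ ((𝟏 ⇒ 𝟏) ⇒ x) ⁺
    qw5b : ∀ x → ((𝟏 ⇒ 𝟏) ⇒ x) ⁺ ≡ ((x ⇒ 𝟏) ⇒ 𝟏)
    qw5c : ∀ x → ((𝟏 ⇒ 𝟏) ⇒ (x ⁻)) ≡ ((𝟏 ⇒ 𝟏) ⇒ x) ⁻
    qw5d : ∀ x → ((𝟏 ⇒ 𝟏) ⇒ x) ⁻ ≡ ((x ⇒ (¬′ 𝟏)) ⇒ (¬′ 𝟏))
    qw6  : ∀ x y → (x ⇒ y) ≡ (((y ⁺) ⇒ (x ⁻)) ⇒ ((x ⁺) ⇒ (y ⁻)))
    qw7  : ∀ x y → ¬′ (x ⇒ y) ≡ (y ⇒ x)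
    qw8  : ∀ x → ¬′ (¬′ x) ≡ x
    qw9  : ∀ x y → (x ⇒ ((¬′ x) ⇒ y)) ⁺ ≡ ((x ⁺) ⇒ ((¬′ (x ⁺)) ⇒ (y ⁺)))
    qw10 : ∀ x y → x ∨ y ≡ y ∨ x
    qw11 : ∀ x y z → x ∨ (y ∨ z) ≡ (x ∨ y) ∨ z
    qw12 : ∀ x y z → (x ⇒ (y ∨ z)) ≡ ((x ⇒ y) ∨ (x ⇒ z))
    strong⁺ : ∀ x → x ⁺ ≡ ((𝟏 ⇒ 𝟏) ⇒ (x ⁺))
    strong⁻ : ∀ x → x ⁻ ≡ ((𝟏 ⇒ 𝟏) ⇒ (x ⁻))

f : {A : Set a} → MVSig A → WSig A
f Q = record
  { _⇒_ = λ x y → (⊖ x) ⊕ y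
  ; ¬′_ = ⊖_
  ; _⁺  = _⁺
  ; _⁻  = _⁻
  ; 𝟏   = 𝟏
  }
  where open MVSig Q

-- g(S): 0 := x → x (taken at x = 1; in a quasi-Wajsberg* algebra x → x
-- does not depend on x),  x ⊕ y := ¬x → y,  -x := ¬x,  same ⁺, ⁻, 1.
g : {A : Set a} → WSig A → MVSig A
g S = record
  { _⊕_ = λ x y → (¬′ x) ⇒ y
  ; ⊖_  = ¬′_
  ; _⁺  = _⁺
  ; _⁻  = _⁻
  ; 𝟎   = 𝟏 ⇒ 𝟏
  ; 𝟏   = 𝟏
  }
  where open WSig S

record _≡MV_ {A : Set a} (M N : MVSig A) : Set a where
  private
    module M = MVSig M
    module N = MVSig N
  field
    ⊕≡ : ∀ x y → x M.⊕ y ≡ x N.⊕ y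
    ⊖≡ : ∀ x → M.⊖ x ≡ N.⊖ x
    ⁺≡ : ∀ x → x M.⁺ ≡ x N.⁺
    ⁻≡ : ∀ x → x M.⁻ ≡ x N.⁻
    𝟎≡ : M.𝟎 ≡ N.𝟎
    𝟏≡ : M.𝟏 ≡ N.𝟏

record _≡W_ {A : Set a} (V W : WSig A) : Set a where
  private
    module V = WSig V
    module W = WSig W
  field
    ⇒≡ : ∀ x y → (x V.⇒ y) ≡ (x W.⇒ y)
    ¬≡ : ∀ x → V.¬′ x ≡ W.¬′ x
    ⁺≡ : ∀ x → x V.⁺ ≡ x W.⁺
    ⁻≡ : ∀ x → x V.⁻ ≡ x W.⁻
    𝟏≡ : V.𝟏 ≡ W.𝟏

module Submission where

open import Defs
open import Level using (Level)
open import Data.Product using (_×_; _,_)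
open import Relation.Binary.PropositionalEquality using (_≡_; refl; cong; setoid)

-- Each round trip only replaces x ⊕ y by --x ⊕ y (resp. x → y by ¬¬x → y) and
-- the zero by -1 ⊕ 1; both unary operations are involutions, and -1 ⊕ 1 = 0
-- by axioms (1) and (8).

module _ {a : Level} {A : Set a} (Q : MVSig A) where
  open MVSig Q
  open import Algebra.Definitions {A = A} _≡_ using (Involutive; LeftInverse)

  g∘f≡id : Involutive ⊖_ → LeftInverse 𝟎 ⊖_ _⊕_ → g (f Q) ≡MV Q
  g∘f≡id ⊖-involutive ⊖-inverseˡ = record
    { ⊕≡ = λ x y → cong (_⊕ y) (⊖-involutive x)
    ; ⊖≡ = λ _ → refl
    ; ⁺≡ = λ _ → refl
    ; ⁻≡ = λ _ → refl
    ; 𝟎≡ = ⊖-inverseˡ 𝟏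
    ; 𝟏≡ = refl
    }

module _ {a : Level} {A : Set a} (S : WSig A) where
  open WSig S
  open import Algebra.Definitions {A = A} _≡_ using (Involutive)

  f∘g≡id : Involutive ¬′_ → f (g S) ≡W S
  f∘g≡id ¬-involutive = record
    { ⇒≡ = λ x y → cong (_⇒ y) (¬-involutive x)
    ; ¬≡ = λ _ → refl
    ; ⁺≡ = λ _ → refl
    ; ⁻≡ = λ _ → refl
    ; 𝟏≡ = refl
    }

module _ {a : Level} {A : Set a} {Q : MVSig A} (isQMV : IsStrongQMV* Q) where
  open MVSig Q
  open IsStrongQMV* isQMV
  open import Algebra.Definitions {A = A} _≡_ using (LeftInverse)
  open import Algebra.Consequences.Setoid (setoid A) using (comm∧invʳ⇒invˡ)

  ⊖-inverseˡ : LeftInverse 𝟎 ⊖_ _⊕_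
  ⊖-inverseˡ = comm∧invʳ⇒invˡ ax1 ax8

theorem3p2 : {a : Level} {A B : Set a} (Q : MVSig A) (S : WSig B)
    → IsStrongQMV* Q → IsStrongQW* S
    → (g (f Q) ≡MV Q) × (f (g S) ≡W S)
theorem3p2 Q S isQMV isQW =
  g∘f≡id Q (IsStrongQMV*.ax10 isQMV) (⊖-inverseˡ isQMV) ,
  f∘g≡id S (IsStrongQW*.qw8 isQW)
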